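{- Let $n\ge d\ge1$ be integers, let $r$ be an integer with $d\le r\le n$, and write $\binom{n}{<d}=\sum_{i=0}^{d-1}\binom{n}{i}$. Suppose $k$ satisfies \[\binom{n}{<d}+\binom{r}{d}+\sum_{i=d+1}^{r-1}\left[\binom{r}{i}-1\right]\le k\le\binom{n}{<d}+\sum_{i=d}^{r}\binom{r}{i}.\] Then $g(n,k,d)=\binom{r}{d}$.
   Context: A family $\mathcal{F}$ of subsets of $[n]=\{1,\dots,n\}$ shatters a set $A\subseteq[n]$ if for every $A'\subseteq A$ there is $F\in\mathcal{F}$ with $F\cap A=A'$. $g(n,k,d)$ denotes the minimum, over all families $\mathcal{F}$ of exactly $k$ distinct subsets of $[n]$, of the number of $d$-element subsets of $[n]$ shattered by $\mathcal{F}$. -}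

module Defs where

open import Data.Nat using (ℕ; suc; _+_; _∸_; _≤_)
open import Data.Nat.Combinatorics using (_C_)
open import Data.List using (List; applyUpTo; length)
open import Data.Nat.ListAction using (sum)
open import Data.List.Membership.Propositional using (_∈_)
open import Data.List.Relation.Unary.Unique.Propositional using (Unique)
open import Data.Fin.Subset using (Subset; _⊆_; _∩_; ∣_∣)
open import Data.Product using (Σ; _×_; ∃; _,_)
open import Function.Bundles using (_⇔_)
open import Relation.Binary.PropositionalEquality using (_≡_)

-- Σ_{i=a}^{b} f i  (empty when b < a)
sumFromTo : ℕ → ℕ → (ℕ → ℕ) → ℕ
sumFromTo a b f = sum (applyUpTo (λ j → f (a + j)) (suc b ∸ a))

binomBelow : ℕ → ℕ → ℕ
binomBelow n d = sum (applyUpTo (λ i → n C i) d)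

-- A family of subsets of [n] is a list of subsets; "k distinct sets" = Unique + length k
Family : ℕ → Set
Family n = List (Subset n)

Shatters : ∀ {n} → Family n → Subset n → Set
Shatters 𝓕 A = ∀ A' → A' ⊆ A → Σ _ λ F → (F ∈ 𝓕) × (F ∩ A ≡ A')

NumShattered : ∀ {n} → Family n → ℕ → ℕ → Set
NumShattered {n} 𝓕 d m =
  Σ (List (Subset n)) λ L → Unique L × length L ≡ m ×
    (∀ A → (A ∈ L) ⇔ ((∣ A ∣ ≡ d) × Shatters 𝓕 A))

-- g(n,k,d) = m : m is the minimum, over families of exactly k distinct subsets
-- of [n], of the number of d-subsets shattered
IsG : ℕ → ℕ → ℕ → ℕ → Set
IsG n k d m =
  ((𝓕 : Family n) → Unique 𝓕 → length 𝓕 ≡ k → ∀ s → NumShattered 𝓕 d s → m ≤ s)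
  × (Σ (Family n) λ 𝓕 → Unique 𝓕 × length 𝓕 ≡ k × NumShattered 𝓕 d m)

-- By Pajor's lemma the sets shattered by a family of k sets form
-- a down-closed family 𝒮 with at least k members. If fewer than C(r,d) of them
-- had size d, then Lovász's form of the Kruskal–Katona theorem, applied to
-- consecutive layers of 𝒮, would leave fewer than C(r,i) shattered i-sets for
-- d ≤ i < r and none of size ≥ r; adding up the layers, 𝒮 would be smaller than
-- the lower bound on k. Conversely, all sets of size < d, all d-subsets of [r]
-- and enough larger subsets of [r] form k sets that shatter exactly the
-- d-subsets of [r].
module Submission where

open import Defs
open import Data.Nat using (ℕ; _+_; _∸_; _≤_; suc)
open import Data.Nat.Combinatorics using (_C_)

open import Data.Bool using (Bool; true; false; T; _∧_; _∨_; not; if_then_else_)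
import Data.Bool as Bool
open import Data.Bool.Properties using (T-≡; T-not-≡; T-∧; T-∨; ∧-identityʳ; ∧-distribˡ-∨)
open import Data.Empty using (⊥-elim)
open import Data.Fin.Subset using (Subset; ∣_∣; _⊆_; _∩_) renaming (_∈_ to _∈ₛ_)
open import Data.Fin.Subset.Properties using (∣p∣≤n; drop-∷-⊆; p⊆q⇒∣p∣≤∣q∣; x∈p∩q⁻)
open import Data.List using (List; []; _∷_; _++_; applyUpTo; length; map; take)
open import Data.List.Membership.Propositional using (_∈_)
open import Data.List.Membership.Propositional.Properties
  using (∈-map⁺; ∈-map⁻; ∈-++⁺ˡ; ∈-++⁺ʳ; ∈-++⁻)
open import Data.List.Properties using (applyUpTo-∷ʳ; length-++; length-map; length-take)
open import Data.List.Relation.Binary.Sublist.Propositional.Properties using (Any-resp-⊆; take-⊆)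
open import Data.List.Relation.Unary.All as All using ([])
open import Data.List.Relation.Unary.AllPairs using ([]; _∷_)
open import Data.List.Relation.Unary.Any using (any?; here)
open import Data.List.Relation.Unary.Unique.Propositional using (Unique)
open import Data.List.Relation.Unary.Unique.Propositional.Properties using (map⁺; ++⁺; take⁺)
open import Data.Nat
  using (zero; _<_; _⊓_; _≡ᵇ_; _<ᵇ_; _≤?_; z≤n; s≤s; z<s; _≤′_; ≤′-reflexive; ≤′-step)
open import Data.Nat.Combinatorics using (nCk+nC[k+1]≡[n+1]C[k+1]; nCn≡1; nC1≡n)
open import Data.Nat.ListAction using (sum)
open import Data.Nat.ListAction.Properties using (sum-++)
open import Data.Nat.Properties
open import Data.Nat.Solver using (module +-*-Solver)
open import Data.Product using (Σ; ∃; _×_; _,_; proj₁; proj₂)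
open import Data.Sum using (inj₁; inj₂)
open import Data.Unit using (⊤; tt)
open import Data.Vec using ([]; _∷_; here)
open import Data.Vec.Properties using (∷-injective; ≡-dec)
open import Function.Base using (id; _∘′_)
open import Function.Bundles using (Equivalence; _⇔_; mk⇔)
open import Relation.Binary.PropositionalEquality
open import Relation.Nullary using (¬_; yes; no; does)
open import Relation.Nullary.Decidable using (Dec; toWitness; fromWitness; isYes≗does)

open import Algebra.Properties.CommutativeSemigroup +-commutativeSemigroup using (interchange)
open +-*-Solver using (solve; _:+_; _:=_)
open Equivalence using (to; from)

private variable
  n k r : ℕ

k≤n⇒0<nCk : k ≤ n → 0 < n C k
k≤n⇒0<nCk {zero}          _         = z<s
k≤n⇒0<nCk {suc k} {suc n} (s≤s k≤n) =
  subst (0 <_) (nCk+nC[k+1]≡[n+1]C[k+1] n k) (<-≤-trans (k≤n⇒0<nCk k≤n) (m≤m+n _ _))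

nCk≤[n+1]Ck : ∀ n k → n C k ≤ suc n C k
nCk≤[n+1]Ck n zero    = ≤-refl
nCk≤[n+1]Ck n (suc k) = subst (n C suc k ≤_) (nCk+nC[k+1]≡[n+1]C[k+1] n k) (m≤n+m _ _)

C-monoˡ-≤ : r ≤ n → r C k ≤ n C k
C-monoˡ-≤ {r} {n} {k} r≤n = mono′ (≤⇒≤′ r≤n)
  where
  mono′ : ∀ {n} → r ≤′ n → r C k ≤ n C k
  mono′ (≤′-reflexive refl) = ≤-refl
  mono′ (≤′-step r≤′n)      = ≤-trans (mono′ r≤′n) (nCk≤[n+1]Ck _ k)

sum-applyUpTo-+ : ∀ (f : ℕ → ℕ) a b →
                  sum (applyUpTo f (a + b)) ≡
                  sum (applyUpTo f a) + sum (applyUpTo (λ j → f (a + j)) b)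
sum-applyUpTo-+ f zero    b = refl
sum-applyUpTo-+ f (suc a) b =
  trans (cong (f 0 +_) (sum-applyUpTo-+ (f ∘′ suc) a b)) (sym (+-assoc (f 0) _ _))

sum-applyUpTo-suc : ∀ (f : ℕ → ℕ) b → sum (applyUpTo f (suc b)) ≡ sum (applyUpTo f b) + f b
sum-applyUpTo-suc f b = begin
  sum (applyUpTo f (suc b))              ≡⟨ cong sum (applyUpTo-∷ʳ f b) ⟨
  sum (applyUpTo f b ++ f b ∷ [])        ≡⟨ sum-++ (applyUpTo f b) (f b ∷ []) ⟩
  sum (applyUpTo f b) + (f b + 0)        ≡⟨ cong (sum (applyUpTo f b) +_) (+-identityʳ (f b)) ⟩
  sum (applyUpTo f b) + f b              ∎
  where open ≡-Reasoning

sum-applyUpTo-mono : ∀ {f g : ℕ → ℕ} m → (∀ j → j < m → f j ≤ g j) →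
                     sum (applyUpTo f m) ≤ sum (applyUpTo g m)
sum-applyUpTo-mono zero    f≤g = z≤n
sum-applyUpTo-mono (suc m) f≤g =
  +-mono-≤ (f≤g 0 z<s) (sum-applyUpTo-mono m (λ j j<m → f≤g (suc j) (s≤s j<m)))

sum-applyUpTo-cong : ∀ {f g : ℕ → ℕ} m → (∀ j → f j ≡ g j) →
                     sum (applyUpTo f m) ≡ sum (applyUpTo g m)
sum-applyUpTo-cong zero    f≡g = refl
sum-applyUpTo-cong (suc m) f≡g = cong₂ _+_ (f≡g 0) (sum-applyUpTo-cong m (λ j → f≡g (suc j)))

sum-applyUpTo-zero : ∀ {f : ℕ → ℕ} m → (∀ j → f j ≡ 0) → sum (applyUpTo f m) ≡ 0
sum-applyUpTo-zero zero    f≡0 = refl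
sum-applyUpTo-zero (suc m) f≡0 = cong₂ _+_ (f≡0 0) (sum-applyUpTo-zero m (λ j → f≡0 (suc j)))

sumFromTo-unfold : ∀ {a b} (f : ℕ → ℕ) → a ≤ b → sumFromTo a b f ≡ f a + sumFromTo (suc a) b f
sumFromTo-unfold {a} {b} f a≤b = begin
  sum (applyUpTo (λ j → f (a + j)) (suc b ∸ a))
    ≡⟨ cong (λ m → sum (applyUpTo (λ j → f (a + j)) m)) (+-∸-assoc 1 a≤b) ⟩
  f (a + 0) + sum (applyUpTo (λ j → f (a + suc j)) (b ∸ a))
    ≡⟨ cong₂ _+_ (cong f (+-identityʳ a)) (sum-applyUpTo-cong (b ∸ a) (λ j → cong f (+-suc a j))) ⟩
  f a + sum (applyUpTo (λ j → f (suc a + j)) (b ∸ a)) ∎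
  where open ≡-Reasoning

m+n≤o+p⇒p<m⇒n<o : ∀ {m n o p} → m + n ≤ o + p → p < m → n < o
m+n≤o+p⇒p<m⇒n<o {m} {n} {o} {p} m+n≤o+p p<m =
  +-cancelˡ-< m n o (≤-<-trans m+n≤o+p (subst (o + p <_) (+-comm o m) (+-monoʳ-< o p<m)))

<∸⇒+< : ∀ a {j r} → j < r ∸ a → a + j < r
<∸⇒+< zero                j<r   = j<r
<∸⇒+< (suc a) {r = suc r} j<r∸a = s≤s (<∸⇒+< a j<r∸a)

<⇒≤∸1 : ∀ {x y} → x < y → x ≤ y ∸ 1
<⇒≤∸1 {x} {y} x<y = m+n≤o⇒m≤o∸n x (subst (_≤ y) (+-comm 1 x) x<y)

∣∷∣-cong : ∀ b {A A' : Subset n} → ∣ A ∣ ≡ ∣ A' ∣ → ∣ b ∷ A ∣ ≡ ∣ b ∷ A' ∣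
∣∷∣-cong false eq = eq
∣∷∣-cong true  eq = cong suc eq

∣∷∷∣-comm : ∀ a b (A : Subset n) → ∣ a ∷ b ∷ A ∣ ≡ ∣ b ∷ a ∷ A ∣
∣∷∷∣-comm false false A = refl
∣∷∷∣-comm false true  A = refl
∣∷∷∣-comm true  false A = refl
∣∷∷∣-comm true  true  A = refl

⊆⇒∩≡ : {A B : Subset n} → A ⊆ B → A ∩ B ≡ A
⊆⇒∩≡ {A = []}        {[]}        A⊆B = refl
⊆⇒∩≡ {A = false ∷ A} {_ ∷ B}     A⊆B = cong (false ∷_) (⊆⇒∩≡ (drop-∷-⊆ A⊆B))
⊆⇒∩≡ {A = true  ∷ A} {true ∷ B}  A⊆B = cong (true ∷_) (⊆⇒∩≡ (drop-∷-⊆ A⊆B))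
⊆⇒∩≡ {A = true  ∷ A} {false ∷ B} A⊆B with A⊆B here
... | ()

∩≡⇒⊆ : {X A : Subset n} → X ∩ A ≡ A → A ⊆ X
∩≡⇒⊆ {X = X} {A} X∩A≡A x∈A = proj₁ (x∈p∩q⁻ X A (subst (_ ∈ₛ_) (sym X∩A≡A) x∈A))

-- Set systems, counted layer by layer

-- Set systems on {0, …, n - 1} are Boolean predicates. Most definitions recurse
-- on coordinate 0: 𝒜 ₀ consists of the members without 0, 𝒜 ₁ of the members
-- with 0, with 0 deleted.
SetSystem : ℕ → Set
SetSystem n = Subset n → Bool

infix 10 _₀ _₁
infixr 7 _∩ₛ_
infixr 6 _∪ₛ_
infix 4 _⊆ₛ_

_₀ _₁ : SetSystem (suc n) → SetSystem n
(𝒜 ₀) A = 𝒜 (false ∷ A)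
(𝒜 ₁) A = 𝒜 (true ∷ A)

_∪ₛ_ _∩ₛ_ : SetSystem n → SetSystem n → SetSystem n
(𝒜 ∪ₛ ℬ) A = 𝒜 A ∨ ℬ A
(𝒜 ∩ₛ ℬ) A = 𝒜 A ∧ ℬ A

∁ₛ : SetSystem n → SetSystem n
∁ₛ 𝒜 A = not (𝒜 A)

_⊆ₛ_ : SetSystem n → SetSystem n → Set
𝒜 ⊆ₛ ℬ = ∀ A → T (𝒜 A) → T (ℬ A)

∩ₛ⊆ˡ : (𝒜 ℬ : SetSystem n) → 𝒜 ∩ₛ ℬ ⊆ₛ 𝒜
∩ₛ⊆ˡ 𝒜 ℬ A = proj₁ ∘′ to (T-∧ {𝒜 A})

∩ₛ⊆ʳ : (𝒜 ℬ : SetSystem n) → 𝒜 ∩ₛ ℬ ⊆ₛ ℬ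
∩ₛ⊆ʳ 𝒜 ℬ A = proj₂ ∘′ to (T-∧ {𝒜 A})

⊆∪ₛˡ : (𝒜 ℬ : SetSystem n) → 𝒜 ⊆ₛ 𝒜 ∪ₛ ℬ
⊆∪ₛˡ 𝒜 ℬ A = from (T-∨ {𝒜 A}) ∘′ inj₁

⊆∪ₛʳ : (𝒜 ℬ : SetSystem n) → ℬ ⊆ₛ 𝒜 ∪ₛ ℬ
⊆∪ₛʳ 𝒜 ℬ A = from (T-∨ {𝒜 A}) ∘′ inj₂

∪ₛ-least : {𝒜 ℬ 𝒞 : SetSystem n} → 𝒜 ⊆ₛ 𝒞 → ℬ ⊆ₛ 𝒞 → 𝒜 ∪ₛ ℬ ⊆ₛ 𝒞
∪ₛ-least {𝒜 = 𝒜} 𝒜⊆𝒞 ℬ⊆𝒞 A p with to (T-∨ {𝒜 A}) p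
... | inj₁ a = 𝒜⊆𝒞 A a
... | inj₂ b = ℬ⊆𝒞 A b

∩ₛ-mono : {𝒜 ℬ 𝒜' ℬ' : SetSystem n} → 𝒜 ⊆ₛ ℬ → 𝒜' ⊆ₛ ℬ' → 𝒜 ∩ₛ 𝒜' ⊆ₛ ℬ ∩ₛ ℬ'
∩ₛ-mono sub sub' A p with to T-∧ p
... | a , a' = from T-∧ (sub A a , sub' A a')

∪ₛ-mono : {𝒜 ℬ 𝒜' ℬ' : SetSystem n} → 𝒜 ⊆ₛ ℬ → 𝒜' ⊆ₛ ℬ' → 𝒜 ∪ₛ 𝒜' ⊆ₛ ℬ ∪ₛ ℬ'
∪ₛ-mono sub sub' A p with to T-∨ p
... | inj₁ a  = from T-∨ (inj₁ (sub A a))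
... | inj₂ a' = from T-∨ (inj₂ (sub' A a'))

card : SetSystem n → ℕ
card {zero}  𝒜 = if 𝒜 [] then 1 else 0
card {suc n} 𝒜 = card (𝒜 ₀) + card (𝒜 ₁)

card-cong : {𝒜 ℬ : SetSystem n} → (∀ A → 𝒜 A ≡ ℬ A) → card 𝒜 ≡ card ℬ
card-cong {zero}  eq = cong (λ b → if b then 1 else 0) (eq [])
card-cong {suc n} eq =
  cong₂ _+_ (card-cong (λ A → eq (false ∷ A))) (card-cong (λ A → eq (true ∷ A)))

card-mono : {𝒜 ℬ : SetSystem n} → 𝒜 ⊆ₛ ℬ → card 𝒜 ≤ card ℬ
card-mono {zero} {𝒜} {ℬ} sub with 𝒜 [] | ℬ [] | sub []
... | false | _     | _   = z≤n
... | true  | true  | _   = ≤-refl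
... | true  | false | sub = ⊥-elim (sub _)
card-mono {suc n} sub =
  +-mono-≤ (card-mono (λ A → sub (false ∷ A))) (card-mono (λ A → sub (true ∷ A)))

card-none : {𝒜 : SetSystem n} → (∀ A → ¬ T (𝒜 A)) → card 𝒜 ≡ 0
card-none {zero} {𝒜} none with 𝒜 [] | none []
... | false | _      = refl
... | true  | ¬true = ⊥-elim (¬true tt)
card-none {suc n} none =
  cong₂ _+_ (card-none (λ A → none (false ∷ A))) (card-none (λ A → none (true ∷ A)))

card-∅ : card {n} (λ _ → false) ≡ 0
card-∅ {n} = card-none {n} (λ _ ())

card-∪-∩ : (𝒜 ℬ : SetSystem n) → card (𝒜 ∪ₛ ℬ) + card (𝒜 ∩ₛ ℬ) ≡ card 𝒜 + card ℬ
card-∪-∩ {zero} 𝒜 ℬ with 𝒜 [] | ℬ []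
... | false | false = refl
... | false | true  = refl
... | true  | false = refl
... | true  | true  = refl
card-∪-∩ {suc n} 𝒜 ℬ = begin
  (card (𝒜 ₀ ∪ₛ ℬ ₀) + card (𝒜 ₁ ∪ₛ ℬ ₁)) + (card (𝒜 ₀ ∩ₛ ℬ ₀) + card (𝒜 ₁ ∩ₛ ℬ ₁))
    ≡⟨ interchange (card (𝒜 ₀ ∪ₛ ℬ ₀)) _ _ _ ⟩
  (card (𝒜 ₀ ∪ₛ ℬ ₀) + card (𝒜 ₀ ∩ₛ ℬ ₀)) + (card (𝒜 ₁ ∪ₛ ℬ ₁) + card (𝒜 ₁ ∩ₛ ℬ ₁))
    ≡⟨ cong₂ _+_ (card-∪-∩ (𝒜 ₀) (ℬ ₀)) (card-∪-∩ (𝒜 ₁) (ℬ ₁)) ⟩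
  (card (𝒜 ₀) + card (ℬ ₀)) + (card (𝒜 ₁) + card (ℬ ₁))
    ≡⟨ interchange (card (𝒜 ₀)) _ _ _ ⟩
  card 𝒜 + card ℬ ∎
  where open ≡-Reasoning

card-disjoint-∪ : (𝒜 ℬ : SetSystem n) → (∀ A → T (𝒜 A) → ¬ T (ℬ A)) →
                  card (𝒜 ∪ₛ ℬ) ≡ card 𝒜 + card ℬ
card-disjoint-∪ 𝒜 ℬ disjoint = begin
  card (𝒜 ∪ₛ ℬ)                     ≡⟨ +-identityʳ _ ⟨
  card (𝒜 ∪ₛ ℬ) + 0                 ≡⟨ cong (card (𝒜 ∪ₛ ℬ) +_) (card-none both) ⟨
  card (𝒜 ∪ₛ ℬ) + card (𝒜 ∩ₛ ℬ)     ≡⟨ card-∪-∩ 𝒜 ℬ ⟩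
  card 𝒜 + card ℬ                   ∎
  where
  open ≡-Reasoning
  both : ∀ A → ¬ T ((𝒜 ∩ₛ ℬ) A)
  both A p = disjoint A (∩ₛ⊆ˡ 𝒜 ℬ A p) (∩ₛ⊆ʳ 𝒜 ℬ A p)

card-split : (𝒜 ℬ : SetSystem n) → card 𝒜 ≡ card (𝒜 ∩ₛ ℬ) + card (𝒜 ∩ₛ ∁ₛ ℬ)
card-split 𝒜 ℬ =
  trans (card-cong (λ A → split (𝒜 A) (ℬ A))) (card-disjoint-∪ (𝒜 ∩ₛ ℬ) (𝒜 ∩ₛ ∁ₛ ℬ) disjoint)
  where
  split : ∀ a b → a ≡ (a ∧ b) ∨ (a ∧ not b)
  split false _     = refl
  split true  false = refl
  split true  true  = refl
  disjoint : ∀ A → T ((𝒜 ∩ₛ ℬ) A) → ¬ T ((𝒜 ∩ₛ ∁ₛ ℬ) A)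
  disjoint A p q with ℬ A | ∩ₛ⊆ʳ 𝒜 ℬ A p | ∩ₛ⊆ʳ 𝒜 (∁ₛ ℬ) A q
  ... | false | () | _
  ... | true  | _  | ()

layer : ℕ → SetSystem n
layer i A = ∣ A ∣ ≡ᵇ i

below : ℕ → SetSystem n
below b A = ∣ A ∣ <ᵇ b

-- A ⊆ {0, …, r - 1}
inFirst : ℕ → SetSystem n
inFirst zero    A       = ∣ A ∣ ≡ᵇ 0
inFirst (suc r) []      = true
inFirst (suc r) (_ ∷ A) = inFirst r A

<ᵇ-suc : ∀ m b → (m <ᵇ suc b) ≡ (m <ᵇ b) ∨ (m ≡ᵇ b)
<ᵇ-suc zero    zero    = refl
<ᵇ-suc zero    (suc b) = refl
<ᵇ-suc (suc m) zero    = refl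
<ᵇ-suc (suc m) (suc b) = <ᵇ-suc m b

card-below : (𝒜 : SetSystem n) (b : ℕ) →
             card (𝒜 ∩ₛ below b) ≡ sum (applyUpTo (λ i → card (𝒜 ∩ₛ layer i)) b)
card-below 𝒜 zero    = card-none (∩ₛ⊆ʳ 𝒜 (below 0))
card-below 𝒜 (suc b) = begin
  card (𝒜 ∩ₛ below (suc b))
    ≡⟨ card-cong (λ A → trans (cong (𝒜 A ∧_) (<ᵇ-suc ∣ A ∣ b)) (∧-distribˡ-∨ (𝒜 A) _ _)) ⟩
  card (𝒜 ∩ₛ below b ∪ₛ 𝒜 ∩ₛ layer b)
    ≡⟨ card-disjoint-∪ (𝒜 ∩ₛ below b) (𝒜 ∩ₛ layer b) disjoint ⟩
  card (𝒜 ∩ₛ below b) + card (𝒜 ∩ₛ layer b)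
    ≡⟨ cong (_+ card (𝒜 ∩ₛ layer b)) (card-below 𝒜 b) ⟩
  sum (applyUpTo (λ i → card (𝒜 ∩ₛ layer i)) b) + card (𝒜 ∩ₛ layer b)
    ≡⟨ sum-applyUpTo-suc (λ i → card (𝒜 ∩ₛ layer i)) b ⟨
  sum (applyUpTo (λ i → card (𝒜 ∩ₛ layer i)) (suc b)) ∎
  where
  open ≡-Reasoning
  disjoint : ∀ A → T ((𝒜 ∩ₛ below b) A) → ¬ T ((𝒜 ∩ₛ layer b) A)
  disjoint A p q =
    <-irrefl (≡ᵇ⇒≡ ∣ A ∣ b (∩ₛ⊆ʳ 𝒜 (layer b) A q)) (<ᵇ⇒< ∣ A ∣ b (∩ₛ⊆ʳ 𝒜 (below b) A p))

card-by-layers : (𝒜 : SetSystem n) → card 𝒜 ≡ sum (applyUpTo (λ i → card (𝒜 ∩ₛ layer i)) (suc n))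
card-by-layers {n} 𝒜 = trans (card-cong all-below) (card-below 𝒜 (suc n))
  where
  all-below : ∀ A → 𝒜 A ≡ (𝒜 ∩ₛ below (suc n)) A
  all-below A = sym (trans (cong (𝒜 A ∧_) (to T-≡ (<⇒<ᵇ (s≤s (∣p∣≤n A))))) (∧-identityʳ (𝒜 A)))

inFirst-all : (A : Subset n) → T (inFirst n A)
inFirst-all []      = tt
inFirst-all (_ ∷ A) = inFirst-all A

card-inFirst-layer : ∀ r i → r ≤ n → card {n} (inFirst r ∩ₛ layer i) ≡ r C i
card-inFirst-layer {zero}  zero    zero    _ = refl
card-inFirst-layer {zero}  zero    (suc i) _ = refl
card-inFirst-layer {suc n} zero    i       _ =
  trans (cong₂ _+_ (card-inFirst-layer {n} zero i z≤n) (card-∅ {n}))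
        (+-identityʳ _)
card-inFirst-layer {suc n} (suc r) zero    (s≤s r≤n) =
  cong₂ _+_ (card-inFirst-layer {n} r zero r≤n) (card-none (∩ₛ⊆ʳ (inFirst {n} r) (λ _ → false)))
card-inFirst-layer {suc n} (suc r) (suc i) (s≤s r≤n) = begin
  card (inFirst {n} r ∩ₛ layer (suc i)) + card (inFirst {n} r ∩ₛ layer i)
    ≡⟨ cong₂ _+_ (card-inFirst-layer {n} r (suc i) r≤n) (card-inFirst-layer {n} r i r≤n) ⟩
  r C suc i + r C i
    ≡⟨ +-comm (r C suc i) (r C i) ⟩
  r C i + r C suc i
    ≡⟨ nCk+nC[k+1]≡[n+1]C[k+1] r i ⟩
  suc r C suc i ∎
  where open ≡-Reasoning

card-layer : ∀ i → card {n} (layer i) ≡ n C i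
card-layer {n} i = trans (card-cong within) (card-inFirst-layer n i ≤-refl)
  where
  within : (A : Subset n) → layer i A ≡ (inFirst n ∩ₛ layer i) A
  within A = cong (_∧ layer i A) (sym (to T-≡ (inFirst-all A)))

inFirst-size : ∀ r {A : Subset n} → T (inFirst r A) → ∣ A ∣ ≤ r
inFirst-size zero    {A}         p = ≤-reflexive (≡ᵇ⇒≡ ∣ A ∣ 0 p)
inFirst-size (suc r) {[]}        p = z≤n
inFirst-size (suc r) {false ∷ A} p = m≤n⇒m≤1+n (inFirst-size r p)
inFirst-size (suc r) {true  ∷ A} p = s≤s (inFirst-size r p)

inFirst-⊆ : ∀ r {A B : Subset n} → A ⊆ B → T (inFirst r B) → T (inFirst r A)
inFirst-⊆ zero    {A} {B}        A⊆B p =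
  ≡⇒≡ᵇ ∣ A ∣ 0 (n≤0⇒n≡0 (≤-trans (p⊆q⇒∣p∣≤∣q∣ A⊆B) (≤-reflexive (≡ᵇ⇒≡ ∣ B ∣ 0 p))))
inFirst-⊆ (suc r) {[]}    {[]}    A⊆B p = tt
inFirst-⊆ (suc r) {_ ∷ A} {_ ∷ B} A⊆B p = inFirst-⊆ r (drop-∷-⊆ A⊆B) p

-- Shadows, compression and the Kruskal–Katona theorem

infix 4 ∂_⊆ₛ_

-- ∂ 𝒜 ⊆ₛ ℬ : deleting one element from a member of 𝒜 always gives a member of ℬ.
-- By recursion on the first coordinate: deleting it, or deleting another
-- element from a member without it, or from a member with it.
∂_⊆ₛ_ : SetSystem n → SetSystem n → Set
∂_⊆ₛ_ {zero}  𝒜 ℬ = ⊤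
∂_⊆ₛ_ {suc n} 𝒜 ℬ = 𝒜 ₁ ⊆ₛ ℬ ₀ × ∂ 𝒜 ₀ ⊆ₛ ℬ ₀ × ∂ 𝒜 ₁ ⊆ₛ ℬ ₁

∂-mono : {𝒜 ℬ 𝒜' ℬ' : SetSystem n} → 𝒜' ⊆ₛ 𝒜 → ℬ ⊆ₛ ℬ' → ∂ 𝒜 ⊆ₛ ℬ → ∂ 𝒜' ⊆ₛ ℬ'
∂-mono {zero}  _    _    _                 = tt
∂-mono {suc n} 𝒜'⊆𝒜 ℬ⊆ℬ' (𝒜₁⊆ℬ₀ , ∂₀ , ∂₁) =
  (λ A → ℬ⊆ℬ' (false ∷ A) ∘′ 𝒜₁⊆ℬ₀ A ∘′ 𝒜'⊆𝒜 (true ∷ A)) ,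
  ∂-mono (λ A → 𝒜'⊆𝒜 (false ∷ A)) (λ A → ℬ⊆ℬ' (false ∷ A)) ∂₀ ,
  ∂-mono (λ A → 𝒜'⊆𝒜 (true ∷ A)) (λ A → ℬ⊆ℬ' (true ∷ A)) ∂₁

∂-∩ : {𝒜 ℬ 𝒜' ℬ' : SetSystem n} → ∂ 𝒜 ⊆ₛ ℬ → ∂ 𝒜' ⊆ₛ ℬ' → ∂ 𝒜 ∩ₛ 𝒜' ⊆ₛ ℬ ∩ₛ ℬ'
∂-∩ {zero}  _                 _                    = tt
∂-∩ {suc n} (𝒜₁⊆ℬ₀ , ∂₀ , ∂₁) (𝒜'₁⊆ℬ'₀ , ∂'₀ , ∂'₁) =
  ∩ₛ-mono 𝒜₁⊆ℬ₀ 𝒜'₁⊆ℬ'₀ , ∂-∩ ∂₀ ∂'₀ , ∂-∩ ∂₁ ∂'₁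

∂-∪ : {𝒜 ℬ 𝒜' ℬ' : SetSystem n} → ∂ 𝒜 ⊆ₛ ℬ → ∂ 𝒜' ⊆ₛ ℬ' → ∂ 𝒜 ∪ₛ 𝒜' ⊆ₛ ℬ ∪ₛ ℬ'
∂-∪ {zero}  _                 _                    = tt
∂-∪ {suc n} (𝒜₁⊆ℬ₀ , ∂₀ , ∂₁) (𝒜'₁⊆ℬ'₀ , ∂'₀ , ∂'₁) =
  ∪ₛ-mono 𝒜₁⊆ℬ₀ 𝒜'₁⊆ℬ'₀ , ∂-∪ ∂₀ ∂'₀ , ∂-∪ ∂₁ ∂'₁

Uniform : ℕ → SetSystem n → Set
Uniform k 𝒜 = 𝒜 ⊆ₛ layer k

∂-nonempty : {𝒜 ℬ : SetSystem n} → Uniform (suc k) 𝒜 → ∂ 𝒜 ⊆ₛ ℬ → 0 < card 𝒜 → 0 < card ℬ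
∂-nonempty {zero} {𝒜 = 𝒜} uniform _ nonempty with 𝒜 [] | uniform []
... | true  | size≡suc = ⊥-elim (size≡suc tt)
... | false | _        = ⊥-elim (<-irrefl refl nonempty)
∂-nonempty {suc n} {𝒜 = 𝒜} {ℬ} uniform (𝒜₁⊆ℬ₀ , ∂₀ , _) nonempty
  with card (𝒜 ₀) | ∂-nonempty (λ A → uniform (false ∷ A)) ∂₀
... | zero  | _  = <-≤-trans nonempty (≤-trans (card-mono 𝒜₁⊆ℬ₀) (m≤m+n _ (card (ℬ ₁))))
... | suc _ | ih = <-≤-trans (ih z<s) (m≤m+n _ (card (ℬ ₁)))

∂-layer₀ : (𝒜 ℬ : SetSystem n) → ∂ 𝒜 ∩ₛ layer 0 ⊆ₛ ℬ
∂-layer₀ {zero}  𝒜 ℬ = tt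
∂-layer₀ {suc n} 𝒜 ℬ =
  (λ A p → ⊥-elim (∩ₛ⊆ʳ (𝒜 ₁) (λ _ → false) A p)) ,
  ∂-layer₀ (𝒜 ₀) (ℬ ₀) ,
  ∂-mono (λ A p → ⊥-elim (∩ₛ⊆ʳ (𝒜 ₁) (λ _ → false) A p)) (λ _ → id) (∂-layer₀ (𝒜 ₁) (ℬ ₁))

∂-layer : ∀ i {𝒜 ℬ : SetSystem n} → ∂ 𝒜 ⊆ₛ ℬ → ∂ 𝒜 ∩ₛ layer (suc i) ⊆ₛ ℬ ∩ₛ layer i
∂-layer {zero}  i       _                 = tt
∂-layer {suc n} zero    {𝒜} (𝒜₁⊆ℬ₀ , ∂₀ , _) =
  ∩ₛ-mono 𝒜₁⊆ℬ₀ (λ _ → id) , ∂-layer zero ∂₀ , ∂-layer₀ (𝒜 ₁) _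
∂-layer {suc n} (suc i) (𝒜₁⊆ℬ₀ , ∂₀ , ∂₁) =
  ∩ₛ-mono 𝒜₁⊆ℬ₀ (λ _ → id) , ∂-layer (suc i) ∂₀ , ∂-layer i ∂₁

-- The (1 → 0)-shift: a member {1} ∪ B with 0, 1 ∉ B is replaced by {0} ∪ B
-- unless {0} ∪ B is already a member.
shift₀₁ : SetSystem (suc (suc n)) → SetSystem (suc (suc n))
shift₀₁ 𝒜 (false ∷ false ∷ A) = 𝒜 (false ∷ false ∷ A)
shift₀₁ 𝒜 (false ∷ true  ∷ A) = 𝒜 (true ∷ false ∷ A) ∧ 𝒜 (false ∷ true ∷ A)
shift₀₁ 𝒜 (true  ∷ false ∷ A) = 𝒜 (true ∷ false ∷ A) ∨ 𝒜 (false ∷ true ∷ A)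
shift₀₁ 𝒜 (true  ∷ true  ∷ A) = 𝒜 (true ∷ true ∷ A)

card-shift₀₁ : (𝒜 : SetSystem (suc (suc n))) → card (shift₀₁ 𝒜) ≡ card 𝒜
card-shift₀₁ 𝒜 = begin
  (card (𝒜 ₀ ₀) + card (𝒜 ₁ ₀ ∩ₛ 𝒜 ₀ ₁)) + (card (𝒜 ₁ ₀ ∪ₛ 𝒜 ₀ ₁) + card (𝒜 ₁ ₁))
    ≡⟨ solve 4 (λ a b c d → (a :+ b) :+ (c :+ d) := (a :+ d) :+ (c :+ b)) refl
         (card (𝒜 ₀ ₀)) (card (𝒜 ₁ ₀ ∩ₛ 𝒜 ₀ ₁)) (card (𝒜 ₁ ₀ ∪ₛ 𝒜 ₀ ₁)) (card (𝒜 ₁ ₁)) ⟩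
  (card (𝒜 ₀ ₀) + card (𝒜 ₁ ₁)) + (card (𝒜 ₁ ₀ ∪ₛ 𝒜 ₀ ₁) + card (𝒜 ₁ ₀ ∩ₛ 𝒜 ₀ ₁))
    ≡⟨ cong ((card (𝒜 ₀ ₀) + card (𝒜 ₁ ₁)) +_) (card-∪-∩ (𝒜 ₁ ₀) (𝒜 ₀ ₁)) ⟩
  (card (𝒜 ₀ ₀) + card (𝒜 ₁ ₁)) + (card (𝒜 ₁ ₀) + card (𝒜 ₀ ₁))
    ≡⟨ solve 4 (λ a d c b → (a :+ d) :+ (c :+ b) := (a :+ b) :+ (c :+ d)) refl
         (card (𝒜 ₀ ₀)) (card (𝒜 ₁ ₁)) (card (𝒜 ₁ ₀)) (card (𝒜 ₀ ₁)) ⟩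
  card 𝒜 ∎
  where open ≡-Reasoning

shift₀₁-mono : {𝒜 ℬ : SetSystem (suc (suc n))} → 𝒜 ⊆ₛ ℬ → shift₀₁ 𝒜 ⊆ₛ shift₀₁ ℬ
shift₀₁-mono sub (false ∷ false ∷ A) = sub _
shift₀₁-mono sub (false ∷ true  ∷ A) =
  ∩ₛ-mono (λ A → sub (true ∷ false ∷ A)) (λ A → sub (false ∷ true ∷ A)) A
shift₀₁-mono sub (true  ∷ false ∷ A) =
  ∪ₛ-mono (λ A → sub (true ∷ false ∷ A)) (λ A → sub (false ∷ true ∷ A)) A
shift₀₁-mono sub (true  ∷ true  ∷ A) = sub _

shift₀₁-sizes : {𝒜 : SetSystem (suc (suc n))} (X : Subset (suc (suc n))) → T (shift₀₁ 𝒜 X) →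
                  ∃ λ X' → T (𝒜 X') × ∣ X' ∣ ≡ ∣ X ∣
shift₀₁-sizes (false ∷ false ∷ A) p = _ , p , refl
shift₀₁-sizes (false ∷ true  ∷ A) p = _ , proj₂ (to T-∧ p) , refl
shift₀₁-sizes (true  ∷ false ∷ A) p with to T-∨ p
... | inj₁ p₁₀ = _ , p₁₀ , refl
... | inj₂ p₀₁ = _ , p₀₁ , refl
shift₀₁-sizes (true  ∷ true  ∷ A) p = _ , p , refl

shift₀₁-∂ : {𝒜 ℬ : SetSystem (suc (suc n))} → ∂ 𝒜 ⊆ₛ ℬ → ∂ shift₀₁ 𝒜 ⊆ₛ shift₀₁ ℬ
shift₀₁-∂ {𝒜 = 𝒜} {ℬ} (𝒜₁⊆ℬ₀ , (𝒜₀₁⊆ℬ₀₀ , ∂₀₀ , ∂₀₁) , (𝒜₁₁⊆ℬ₁₀ , ∂₁₀ , ∂₁₁)) =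
  shifted₁⊆shifted₀ ,
  ((λ A → 𝒜₀₁⊆ℬ₀₀ A ∘′ proj₂ ∘′ to T-∧) , ∂₀₀ , ∂-∩ ∂₁₀ ∂₀₁) ,
  ((λ A → from T-∨ ∘′ inj₁ ∘′ 𝒜₁₁⊆ℬ₁₀ A) , ∂-∪ ∂₁₀ ∂₀₁ , ∂₁₁)
  where
  shifted₁⊆shifted₀ : shift₀₁ 𝒜 ₁ ⊆ₛ shift₀₁ ℬ ₀
  shifted₁⊆shifted₀ (false ∷ A) p with to T-∨ p
  ... | inj₁ p₁₀ = 𝒜₁⊆ℬ₀ (false ∷ A) p₁₀
  ... | inj₂ p₀₁ = 𝒜₀₁⊆ℬ₀₀ A p₀₁
  shifted₁⊆shifted₀ (true ∷ A) p = from T-∧ (𝒜₁₁⊆ℬ₁₀ A p , 𝒜₁⊆ℬ₀ (true ∷ A) p)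

Compressed : SetSystem (suc n) → Set
Compressed 𝒜 = ∂ 𝒜 ₀ ⊆ₛ 𝒜 ₁

slice₁ : Bool → SetSystem (suc (suc n)) → SetSystem (suc n)
slice₁ b 𝒜 (a ∷ A) = 𝒜 (a ∷ b ∷ A)

glue₁ : (Bool → SetSystem (suc n)) → SetSystem (suc (suc n))
glue₁ 𝒢 (a ∷ b ∷ A) = 𝒢 b (a ∷ A)

shift₀₁-compressed : (𝒜 : SetSystem (suc (suc n))) →
                     Compressed (slice₁ false 𝒜) → Compressed (slice₁ true 𝒜) →
                     Compressed (shift₀₁ 𝒜)
shift₀₁-compressed 𝒜 ∂₀₀⊆₁₀ ∂₀₁⊆₁₁ =
  (λ A → ⊆∪ₛˡ (𝒜 ₁ ₀) (𝒜 ₀ ₁) A ∘′ ∩ₛ⊆ˡ (𝒜 ₁ ₀) (𝒜 ₀ ₁) A) ,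
  ∂-mono (λ _ → id) (⊆∪ₛˡ (𝒜 ₁ ₀) (𝒜 ₀ ₁)) ∂₀₀⊆₁₀ ,
  ∂-mono (∩ₛ⊆ʳ (𝒜 ₁ ₀) (𝒜 ₀ ₁)) (λ _ → id) ∂₀₁⊆₁₁

card-slice₁ : (𝒜 : SetSystem (suc (suc n))) → card 𝒜 ≡ card (slice₁ false 𝒜) + card (slice₁ true 𝒜)
card-slice₁ 𝒜 = interchange (card (𝒜 ₀ ₀)) _ _ _

card-glue₁ : (𝒢 : Bool → SetSystem (suc n)) → card (glue₁ 𝒢) ≡ card (𝒢 false) + card (𝒢 true)
card-glue₁ 𝒢 = interchange (card (𝒢 false ₀)) _ _ _

slice₁-mono : ∀ b {𝒜 ℬ : SetSystem (suc (suc n))} → 𝒜 ⊆ₛ ℬ → slice₁ b 𝒜 ⊆ₛ slice₁ b ℬ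
slice₁-mono b sub (a ∷ A) = sub (a ∷ b ∷ A)

glue₁-mono : {𝒢 ℋ : Bool → SetSystem (suc n)} → (∀ b → 𝒢 b ⊆ₛ ℋ b) → glue₁ 𝒢 ⊆ₛ glue₁ ℋ
glue₁-mono sub (a ∷ b ∷ A) = sub b (a ∷ A)

∂-slice₁ : ∀ b {𝒜 ℬ : SetSystem (suc (suc n))} → ∂ 𝒜 ⊆ₛ ℬ → ∂ slice₁ b 𝒜 ⊆ₛ slice₁ b ℬ
∂-slice₁ false (𝒜₁⊆ℬ₀ , (_ , ∂₀₀ , _) , (_ , ∂₁₀ , _)) = (λ A → 𝒜₁⊆ℬ₀ (false ∷ A)) , ∂₀₀ , ∂₁₀
∂-slice₁ true  (𝒜₁⊆ℬ₀ , (_ , _ , ∂₀₁) , (_ , _ , ∂₁₁)) = (λ A → 𝒜₁⊆ℬ₀ (true ∷ A)) , ∂₀₁ , ∂₁₁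

∂-slice₁-cross : {𝒜 ℬ : SetSystem (suc (suc n))} → ∂ 𝒜 ⊆ₛ ℬ → slice₁ true 𝒜 ⊆ₛ slice₁ false ℬ
∂-slice₁-cross (_ , (𝒜₀₁⊆ℬ₀₀ , _) , _)          (false ∷ A) = 𝒜₀₁⊆ℬ₀₀ A
∂-slice₁-cross (_ , _            , (𝒜₁₁⊆ℬ₁₀ , _)) (true  ∷ A) = 𝒜₁₁⊆ℬ₁₀ A

∂-glue₁ : {𝒢 ℋ : Bool → SetSystem (suc n)} →
          𝒢 true ⊆ₛ ℋ false → ∂ 𝒢 false ⊆ₛ ℋ false → ∂ 𝒢 true ⊆ₛ ℋ true →
          ∂ glue₁ 𝒢 ⊆ₛ glue₁ ℋ
∂-glue₁ {𝒢 = 𝒢} {ℋ} cross (𝒢₀₁⊆ℋ₀₀ , ∂₀₀ , ∂₁₀) (𝒢₁₁⊆ℋ₁₀ , ∂₀₁ , ∂₁₁) =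
  glued₁⊆glued₀ ,
  ((λ A → cross (false ∷ A)) , ∂₀₀ , ∂₀₁) ,
  ((λ A → cross (true ∷ A)) , ∂₁₀ , ∂₁₁)
  where
  glued₁⊆glued₀ : glue₁ 𝒢 ₁ ⊆ₛ glue₁ ℋ ₀
  glued₁⊆glued₀ (false ∷ A) = 𝒢₀₁⊆ℋ₀₀ A
  glued₁⊆glued₀ (true  ∷ A) = 𝒢₁₁⊆ℋ₁₀ A

-- Shifts every coordinate to 0: the coordinates ≥ 2 recursively inside the
-- slices at coordinate 1, then coordinate 1.
compress : SetSystem (suc n) → SetSystem (suc n)
compress {zero}  𝒜 = 𝒜
compress {suc n} 𝒜 = shift₀₁ (glue₁ (λ b → compress (slice₁ b 𝒜)))

card-compress : (𝒜 : SetSystem (suc n)) → card (compress 𝒜) ≡ card 𝒜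
card-compress {zero}  𝒜 = refl
card-compress {suc n} 𝒜 = begin
  card (shift₀₁ (glue₁ λ b → compress (slice₁ b 𝒜)))
    ≡⟨ card-shift₀₁ (glue₁ λ b → compress (slice₁ b 𝒜)) ⟩
  card (glue₁ λ b → compress (slice₁ b 𝒜))
    ≡⟨ card-glue₁ (λ b → compress (slice₁ b 𝒜)) ⟩
  card (compress (slice₁ false 𝒜)) + card (compress (slice₁ true 𝒜))
    ≡⟨ cong₂ _+_ (card-compress (slice₁ false 𝒜)) (card-compress (slice₁ true 𝒜)) ⟩
  card (slice₁ false 𝒜) + card (slice₁ true 𝒜)
    ≡⟨ card-slice₁ 𝒜 ⟨
  card 𝒜 ∎
  where open ≡-Reasoning

compress-mono : {𝒜 ℬ : SetSystem (suc n)} → 𝒜 ⊆ₛ ℬ → compress 𝒜 ⊆ₛ compress ℬ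
compress-mono {zero}  sub = sub
compress-mono {suc n} sub =
  shift₀₁-mono (glue₁-mono (λ b → compress-mono (slice₁-mono b sub)))

compress-sizes : {𝒜 : SetSystem (suc n)} (X : Subset (suc n)) → T (compress 𝒜 X) →
                   ∃ λ X' → T (𝒜 X') × ∣ X' ∣ ≡ ∣ X ∣
compress-sizes {zero}          X p = X , p , refl
compress-sizes {suc n} {𝒜 = 𝒜} X p
  with shift₀₁-sizes X p
... | a ∷ b ∷ A , q , ∣aabA∣≡∣X∣
  with compress-sizes {𝒜 = slice₁ b 𝒜} (a ∷ A) q
... | a' ∷ A' , r , ∣a'A'∣≡∣aA∣ = a' ∷ b ∷ A' , r , (begin
  ∣ a' ∷ b ∷ A' ∣ ≡⟨ ∣∷∷∣-comm a' b A' ⟩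
  ∣ b ∷ a' ∷ A' ∣ ≡⟨ ∣∷∣-cong b {a' ∷ A'} {a ∷ A} ∣a'A'∣≡∣aA∣ ⟩
  ∣ b ∷ a ∷ A ∣   ≡⟨ ∣∷∷∣-comm b a A ⟩
  ∣ a ∷ b ∷ A ∣   ≡⟨ ∣aabA∣≡∣X∣ ⟩
  ∣ X ∣           ∎)
  where open ≡-Reasoning

compress-uniform : {𝒜 : SetSystem (suc n)} → Uniform k 𝒜 → Uniform k (compress 𝒜)
compress-uniform {k = k} {𝒜} uniform X p with compress-sizes {𝒜 = 𝒜} X p
... | X' , q , ∣X'∣≡∣X∣ = subst (λ s → T (s ≡ᵇ k)) ∣X'∣≡∣X∣ (uniform X' q)

compress-∂ : {𝒜 ℬ : SetSystem (suc n)} → ∂ 𝒜 ⊆ₛ ℬ → ∂ compress 𝒜 ⊆ₛ compress ℬ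
compress-∂ {zero}  ∂⊆ = ∂⊆
compress-∂ {suc n} {𝒜} {ℬ} ∂⊆ = shift₀₁-∂ (∂-glue₁
  (compress-mono (∂-slice₁-cross {𝒜 = 𝒜} {ℬ} ∂⊆))
  (compress-∂ (∂-slice₁ false {𝒜} {ℬ} ∂⊆))
  (compress-∂ (∂-slice₁ true {𝒜} {ℬ} ∂⊆)))

compress-compressed : (𝒜 : SetSystem (suc n)) → Compressed (compress 𝒜)
compress-compressed {zero}  𝒜 = tt
compress-compressed {suc n} 𝒜 = shift₀₁-compressed (glue₁ λ b → compress (slice₁ b 𝒜))
  (compress-compressed (slice₁ false 𝒜))
  (compress-compressed (slice₁ true 𝒜))

-- Lovász's form of the Kruskal–Katona theorem, for integer r. After compression
-- the shadow of 𝒜 ₀ lies in 𝒜 ₁, so induction on n applies to both slices.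
kruskal-katona : ∀ k r {𝒜 ℬ : SetSystem n} → Uniform (suc k) 𝒜 → ∂ 𝒜 ⊆ₛ ℬ →
                 suc k ≤ r → r C suc k ≤ card 𝒜 → r C k ≤ card ℬ
kruskal-katona zero r uniform ∂⊆ 1≤r big =
  ∂-nonempty uniform ∂⊆ (≤-trans 1≤r (subst (_≤ _) (nC1≡n r) big))
kruskal-katona {zero} (suc k) r {𝒜} uniform _ k<r big with 𝒜 [] | uniform []
... | true  | size≡suc = ⊥-elim (size≡suc tt)
... | false | _        = ⊥-elim (<⇒≱ (k≤n⇒0<nCk k<r) big)
kruskal-katona {suc n} (suc k) (suc r) {𝒜} {ℬ} uniform ∂⊆ (s≤s k<r) big =
  subst₂ _≤_ (nCk+nC[k+1]≡[n+1]C[k+1] r k) (card-compress ℬ) split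
  where
  𝒜' = compress 𝒜
  ℬ' = compress ℬ
  uniform' : Uniform (suc (suc k)) 𝒜'
  uniform' = compress-uniform uniform
  ∂'⊆ : ∂ 𝒜' ⊆ₛ ℬ'
  ∂'⊆ = compress-∂ ∂⊆
  big' : r C suc k + r C suc (suc k) ≤ card (𝒜' ₀) + card (𝒜' ₁)
  big' = subst₂ _≤_ (sym (nCk+nC[k+1]≡[n+1]C[k+1] r (suc k))) (sym (card-compress 𝒜)) big
  members₁ : r C suc k ≤ card (𝒜' ₁)
  members₁ with r C suc k ≤? card (𝒜' ₁)
  ... | yes enough = enough
  -- otherwise 𝒜' ₀ has more than r C suc (suc k) members, and its shadow lies in 𝒜' ₁
  ... | no few with m+n≤o+p⇒p<m⇒n<o big' (≰⇒> few) | m≤n⇒m<n∨m≡n k<r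
  ...   | many₀ | inj₁ k+1<r =
    kruskal-katona (suc k) r (λ A → uniform' (false ∷ A)) (compress-compressed 𝒜) k+1<r (<⇒≤ many₀)
  ...   | many₀ | inj₂ refl  = subst (_≤ card (𝒜' ₁)) (sym (nCn≡1 (suc k)))
    (∂-nonempty (λ A → uniform' (false ∷ A)) (compress-compressed 𝒜) (≤-<-trans z≤n many₀))
  split : r C k + r C suc k ≤ card (ℬ' ₀) + card (ℬ' ₁)
  split = subst (r C k + r C suc k ≤_) (+-comm (card (ℬ' ₁)) _) (+-mono-≤
    (kruskal-katona k r (λ A → uniform' (true ∷ A)) (proj₂ (proj₂ ∂'⊆)) k<r members₁)
    (≤-trans members₁ (card-mono (proj₁ ∂'⊆))))

module DownClosed {𝒮 : SetSystem n} (down : ∂ 𝒮 ⊆ₛ 𝒮) where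

  layer-bound-descends : ∀ {i j} → i ≤ j → j ≤ r →
                         r C j ≤ card (𝒮 ∩ₛ layer j) → r C i ≤ card (𝒮 ∩ₛ layer i)
  layer-bound-descends {j = zero}  z≤n _ big = big
  layer-bound-descends {j = suc j} i≤j+1 j<r big with m≤n⇒m<n∨m≡n i≤j+1
  ... | inj₂ refl      = big
  ... | inj₁ (s≤s i≤j) = layer-bound-descends i≤j (<⇒≤ j<r)
    (kruskal-katona j _ (∩ₛ⊆ʳ 𝒮 (layer (suc j))) (∂-layer j down) j<r big)

  module _ {d r} (d≤r : d ≤ r) (thin : card (𝒮 ∩ₛ layer d) < r C d) where

    higher-layers-thin : ∀ {i} → d ≤ i → i ≤ r → card (𝒮 ∩ₛ layer i) < r C i
    higher-layers-thin d≤i i≤r = ≰⇒> λ big → <⇒≱ thin (layer-bound-descends d≤i i≤r big)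

    top-layers-empty : ∀ {i} → r ≤ i → card (𝒮 ∩ₛ layer i) ≡ 0
    top-layers-empty {i} r≤i = n<1⇒n≡0 (≰⇒> λ nonempty → <⇒≱ thin (≤-trans (C-monoˡ-≤ {k = d} r≤i)
      (layer-bound-descends (≤-trans d≤r r≤i) ≤-refl
        (subst (_≤ card (𝒮 ∩ₛ layer i)) (sym (nCn≡1 i)) nonempty))))

    card<threshold : r ≤ n →
                     card 𝒮 < binomBelow n d + r C d + sumFromTo (suc d) (r ∸ 1) (λ i → r C i ∸ 1)
    card<threshold r≤n = begin-strict
      card 𝒮
        ≡⟨ card-by-layers 𝒮 ⟩
      sum (applyUpTo c (suc n))
        ≡⟨ cong (λ N → sum (applyUpTo c N)) 1+n≡ ⟩
      sum (applyUpTo c (suc d + (m + t)))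
        ≡⟨ sum-applyUpTo-+ c (suc d) (m + t) ⟩
      sum (applyUpTo c (suc d)) + sum (applyUpTo (λ j → c (suc d + j)) (m + t))
        ≡⟨ cong₂ _+_ (sum-applyUpTo-suc c d) (sum-applyUpTo-+ (λ j → c (suc d + j)) m t) ⟩
      (sum (applyUpTo c d) + c d) +
        (sum (applyUpTo (λ j → c (suc d + j)) m) + sum (applyUpTo (λ j → c (suc d + (m + j))) t))
        <⟨ +-mono-<-≤ (+-mono-≤-< lower thin) (+-mono-≤ middle (≤-reflexive top)) ⟩
      (binomBelow n d + r C d) + (sumFromTo (suc d) (r ∸ 1) (λ i → r C i ∸ 1) + 0)
        ≡⟨ cong (binomBelow n d + r C d +_) (+-identityʳ _) ⟩
      binomBelow n d + r C d + sumFromTo (suc d) (r ∸ 1) (λ i → r C i ∸ 1) ∎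
      where
      open ≤-Reasoning
      c : ℕ → ℕ
      c i = card (𝒮 ∩ₛ layer i)
      m = r ∸ 1 ∸ d
      t = n ∸ (d + m)
      1+n≡ : suc n ≡ suc d + (m + t)
      1+n≡ = cong suc (sym (trans (sym (+-assoc d m t)) (m+[n∸m]≡n d+m≤n)))
        where
        d+m≤n : d + m ≤ n
        d+m≤n = ≤-trans (+-monoʳ-≤ d (∸-monoˡ-≤ d (m∸n≤m r 1)))
                        (≤-trans (≤-reflexive (m+[n∸m]≡n d≤r)) r≤n)
      lower : sum (applyUpTo c d) ≤ binomBelow n d
      lower = sum-applyUpTo-mono d λ i _ →
        subst (c i ≤_) (card-layer i) (card-mono (∩ₛ⊆ʳ 𝒮 (layer i)))
      middle : sum (applyUpTo (λ j → c (suc d + j)) m) ≤ sumFromTo (suc d) (r ∸ 1) (λ i → r C i ∸ 1)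
      middle = sum-applyUpTo-mono m λ j j<m → <⇒≤∸1 (higher-layers-thin
        (≤-trans (n≤1+n d) (m≤m+n (suc d) j)) (≤-trans (<∸⇒+< d j<m) (m∸n≤m r 1)))
      top : sum (applyUpTo (λ j → c (suc d + (m + j))) t) ≡ 0
      top = sum-applyUpTo-zero t λ j → top-layers-empty (begin
        r                      ≤⟨ m≤n+m∸n r (suc d) ⟩
        suc d + (r ∸ suc d)    ≡⟨ cong (suc d +_) (∸-+-assoc r 1 d) ⟨
        suc d + m              ≤⟨ +-monoʳ-≤ (suc d) (m≤m+n m j) ⟩
        suc d + (m + j)        ∎)

-- Shattered sets

-- The sets shattered by ℱ. A set without 0 is shattered by ℱ iff it is
-- shattered by the projection ℱ ₀ ∪ₛ ℱ ₁, and a set with 0 iff the rest is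
-- shattered by both ℱ ₀ and ℱ ₁.
shattered : SetSystem n → SetSystem n
shattered {zero}  ℱ []          = ℱ []
shattered {suc n} ℱ (false ∷ A) = shattered (ℱ ₀ ∪ₛ ℱ ₁) A
shattered {suc n} ℱ (true  ∷ A) = shattered (ℱ ₀) A ∧ shattered (ℱ ₁) A

shattered-sound : (ℱ : SetSystem n) (A : Subset n) → T (shattered ℱ A) →
                  ∀ A' → A' ⊆ A → ∃ λ X → T (ℱ X) × X ∩ A ≡ A'
shattered-sound {zero}  ℱ []          p [] _ = [] , p , refl
shattered-sound {suc n} ℱ (false ∷ A) p (true ∷ A') A'⊆A with A'⊆A here
... | ()
shattered-sound {suc n} ℱ (false ∷ A) p (false ∷ A') A'⊆A
  with shattered-sound (ℱ ₀ ∪ₛ ℱ ₁) A p A' (drop-∷-⊆ A'⊆A)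
... | X , q , X∩A≡A' with to (T-∨ {ℱ (false ∷ X)}) q
...   | inj₁ q₀ = false ∷ X , q₀ , cong (false ∷_) X∩A≡A'
...   | inj₂ q₁ = true  ∷ X , q₁ , cong (false ∷_) X∩A≡A'
shattered-sound {suc n} ℱ (true ∷ A) p (false ∷ A') A'⊆A
  with shattered-sound (ℱ ₀) A (proj₁ (to (T-∧ {shattered (ℱ ₀) A}) p)) A' (drop-∷-⊆ A'⊆A)
... | X , q , X∩A≡A' = false ∷ X , q , cong (false ∷_) X∩A≡A'
shattered-sound {suc n} ℱ (true ∷ A) p (true ∷ A') A'⊆A
  with shattered-sound (ℱ ₁) A (proj₂ (to (T-∧ {shattered (ℱ ₀) A}) p)) A' (drop-∷-⊆ A'⊆A)
... | X , q , X∩A≡A' = true ∷ X , q , cong (true ∷_) X∩A≡A'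

shattered-mono : {ℱ 𝒢 : SetSystem n} → ℱ ⊆ₛ 𝒢 → shattered ℱ ⊆ₛ shattered 𝒢
shattered-mono {zero}  ℱ⊆𝒢 []          = ℱ⊆𝒢 []
shattered-mono {suc n} ℱ⊆𝒢 (false ∷ A) =
  shattered-mono (∪ₛ-mono (λ X → ℱ⊆𝒢 (false ∷ X)) (λ X → ℱ⊆𝒢 (true ∷ X))) A
shattered-mono {suc n} ℱ⊆𝒢 (true  ∷ A) =
  ∩ₛ-mono (shattered-mono (λ X → ℱ⊆𝒢 (false ∷ X))) (shattered-mono (λ X → ℱ⊆𝒢 (true ∷ X))) A

shattered-∩⊆shattered-∪ : (ℱ 𝒢 : SetSystem n) → shattered ℱ ∩ₛ shattered 𝒢 ⊆ₛ shattered (ℱ ∪ₛ 𝒢)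
shattered-∩⊆shattered-∪ ℱ 𝒢 A =
  shattered-mono (⊆∪ₛˡ ℱ 𝒢) A ∘′ ∩ₛ⊆ˡ (shattered ℱ) (shattered 𝒢) A

shattered-downClosed : (ℱ : SetSystem n) → ∂ shattered ℱ ⊆ₛ shattered ℱ
shattered-downClosed {zero}  ℱ = tt
shattered-downClosed {suc n} ℱ =
  shattered-∩⊆shattered-∪ (ℱ ₀) (ℱ ₁) ,
  shattered-downClosed (ℱ ₀ ∪ₛ ℱ ₁) ,
  ∂-∩ (shattered-downClosed (ℱ ₀)) (shattered-downClosed (ℱ ₁))

card≤card-shattered : (ℱ : SetSystem n) → card ℱ ≤ card (shattered ℱ)
card≤card-shattered {zero}  ℱ = ≤-refl
card≤card-shattered {suc n} ℱ = begin
  card (ℱ ₀) + card (ℱ ₁)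
    ≤⟨ +-mono-≤ (card≤card-shattered (ℱ ₀)) (card≤card-shattered (ℱ ₁)) ⟩
  card (shattered (ℱ ₀)) + card (shattered (ℱ ₁))
    ≡⟨ card-∪-∩ (shattered (ℱ ₀)) (shattered (ℱ ₁)) ⟨
  card (shattered (ℱ ₀) ∪ₛ shattered (ℱ ₁)) + card (shattered (ℱ ₀) ∩ₛ shattered (ℱ ₁))
    ≤⟨ +-monoˡ-≤ _ (card-mono (∪ₛ-least (shattered-mono (⊆∪ₛˡ (ℱ ₀) (ℱ ₁)))
                                          (shattered-mono (⊆∪ₛʳ (ℱ ₀) (ℱ ₁))))) ⟩
  card (shattered (ℱ ₀ ∪ₛ ℱ ₁)) + card (shattered (ℱ ₀) ∩ₛ shattered (ℱ ₁)) ∎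
  where open ≤-Reasoning

does-sound : {A : Set} (a? : Dec A) → T (does a?) → A
does-sound a? = toWitness ∘′ subst T (sym (isYes≗does a?))

fromList : Family n → SetSystem n
fromList 𝓕 X = does (any? (≡-dec Bool._≟_ X) 𝓕)

fromList-sound : (𝓕 : Family n) {X : Subset n} → T (fromList 𝓕 X) → X ∈ 𝓕
fromList-sound 𝓕 {X} = does-sound (any? (≡-dec Bool._≟_ X) 𝓕)

fromList-complete : (𝓕 : Family n) {X : Subset n} → X ∈ 𝓕 → T (fromList 𝓕 X)
fromList-complete 𝓕 {X} X∈𝓕 =
  subst T (isYes≗does (any? (≡-dec Bool._≟_ X) 𝓕)) (fromWitness X∈𝓕)

card-singleton : (Y : Subset n) → card (λ X → does (≡-dec Bool._≟_ X Y)) ≡ 1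
card-singleton []          = refl
card-singleton {suc n} (false ∷ Y) = cong₂ _+_ (card-singleton Y) (card-∅ {n})
card-singleton {suc n} (true  ∷ Y) = cong₂ _+_ (card-∅ {n}) (card-singleton Y)

card-fromList : (𝓕 : Family n) → Unique 𝓕 → card (fromList 𝓕) ≡ length 𝓕
card-fromList {n} []      _               = card-∅ {n}
card-fromList     (Y ∷ 𝓕) (Y∉𝓕 ∷ unique) = begin
  card ((λ X → does (≡-dec Bool._≟_ X Y)) ∪ₛ fromList 𝓕)
    ≡⟨ card-disjoint-∪ (λ X → does (≡-dec Bool._≟_ X Y)) (fromList 𝓕) disjoint ⟩
  card (λ X → does (≡-dec Bool._≟_ X Y)) + card (fromList 𝓕)
    ≡⟨ cong₂ _+_ (card-singleton Y) (card-fromList 𝓕 unique) ⟩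
  suc (length 𝓕) ∎
  where
  open ≡-Reasoning
  disjoint : ∀ X → T (does (≡-dec Bool._≟_ X Y)) → ¬ T (fromList 𝓕 X)
  disjoint X X≡Y X∈𝓕 = All.lookup Y∉𝓕 (subst (_∈ 𝓕) (does-sound (≡-dec Bool._≟_ X Y) X≡Y)
                                                 (fromList-sound 𝓕 X∈𝓕)) refl

members : SetSystem n → List (Subset n)
members {zero}  𝒜 = if 𝒜 [] then [] ∷ [] else []
members {suc n} 𝒜 = map (false ∷_) (members (𝒜 ₀)) ++ map (true ∷_) (members (𝒜 ₁))

length-members : (𝒜 : SetSystem n) → length (members 𝒜) ≡ card 𝒜
length-members {zero}  𝒜 with 𝒜 []
... | false = refl
... | true  = refl
length-members {suc n} 𝒜 = begin
  length (map (false ∷_) (members (𝒜 ₀)) ++ map (true ∷_) (members (𝒜 ₁)))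
    ≡⟨ length-++ (map (false ∷_) (members (𝒜 ₀))) ⟩
  length (map (false ∷_) (members (𝒜 ₀))) + length (map (true ∷_) (members (𝒜 ₁)))
    ≡⟨ cong₂ _+_ (length-map (false ∷_) (members (𝒜 ₀))) (length-map (true ∷_) (members (𝒜 ₁))) ⟩
  length (members (𝒜 ₀)) + length (members (𝒜 ₁))
    ≡⟨ cong₂ _+_ (length-members (𝒜 ₀)) (length-members (𝒜 ₁)) ⟩
  card 𝒜 ∎
  where open ≡-Reasoning

members-unique : (𝒜 : SetSystem n) → Unique (members 𝒜)
members-unique {zero}  𝒜 with 𝒜 []
... | false = []
... | true  = [] ∷ []
members-unique {suc n} 𝒜 =
  ++⁺ (map⁺ (proj₂ ∘′ ∷-injective) (members-unique (𝒜 ₀)))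
      (map⁺ (proj₂ ∘′ ∷-injective) (members-unique (𝒜 ₁)))
      different-heads
  where
  different-heads : ∀ {X} →
                    ¬ (X ∈ map (false ∷_) (members (𝒜 ₀)) × X ∈ map (true ∷_) (members (𝒜 ₁)))
  different-heads (X∈₀ , X∈₁) with ∈-map⁻ (false ∷_) X∈₀ | ∈-map⁻ (true ∷_) X∈₁
  ... | _ , _ , refl | _ , _ , ()

∈-members⁺ : (𝒜 : SetSystem n) {X : Subset n} → T (𝒜 X) → X ∈ members 𝒜
∈-members⁺ {zero}  𝒜 {[]} p with 𝒜 []
... | true  = here refl
... | false = ⊥-elim p
∈-members⁺ {suc n} 𝒜 {false ∷ X} p = ∈-++⁺ˡ (∈-map⁺ (false ∷_) (∈-members⁺ (𝒜 ₀) p))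
∈-members⁺ {suc n} 𝒜 {true  ∷ X} p =
  ∈-++⁺ʳ (map (false ∷_) (members (𝒜 ₀))) (∈-map⁺ (true ∷_) (∈-members⁺ (𝒜 ₁) p))

∈-members⁻ : (𝒜 : SetSystem n) {X : Subset n} → X ∈ members 𝒜 → T (𝒜 X)
∈-members⁻ {zero}  𝒜 {[]} X∈ with 𝒜 []
... | true  = tt
... | false with X∈
...   | ()
∈-members⁻ {suc n} 𝒜 X∈ with ∈-++⁻ (map (false ∷_) (members (𝒜 ₀))) X∈
... | inj₁ X∈₀ with ∈-map⁻ (false ∷_) X∈₀
...   | _ , Y∈ , refl = ∈-members⁻ (𝒜 ₀) Y∈
∈-members⁻ {suc n} 𝒜 X∈ | inj₂ X∈₁ with ∈-map⁻ (true ∷_) X∈₁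
...   | _ , Y∈ , refl = ∈-members⁻ (𝒜 ₁) Y∈

-- The two bounds

lower-bound : ∀ {n d r k} → d ≤ r → r ≤ n →
              binomBelow n d + r C d + sumFromTo (suc d) (r ∸ 1) (λ i → r C i ∸ 1) ≤ k →
              (𝓕 : Family n) → Unique 𝓕 → length 𝓕 ≡ k → ∀ s → NumShattered 𝓕 d s → r C d ≤ s
lower-bound {n} {d} {r} d≤r r≤n k-large 𝓕 unique refl s (L , L-unique , refl , L-shattered) =
  ≤-trans d-layer-large (subst (card (𝒮 ∩ₛ layer d) ≤_) (card-fromList L L-unique) (card-mono in-L))
  where
  𝒮 = shattered (fromList 𝓕)
  d-layer-large : r C d ≤ card (𝒮 ∩ₛ layer d)
  d-layer-large = ≮⇒≥ λ thin →
    <⇒≱ (DownClosed.card<threshold (shattered-downClosed (fromList 𝓕)) d≤r thin r≤n)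
        (≤-trans k-large
          (subst (_≤ card 𝒮) (card-fromList 𝓕 unique) (card≤card-shattered (fromList 𝓕))))
  in-L : 𝒮 ∩ₛ layer d ⊆ₛ fromList L
  in-L A p = fromList-complete L
    (from (L-shattered A) (≡ᵇ⇒≡ ∣ A ∣ d (∩ₛ⊆ʳ 𝒮 (layer d) A p) , shatters))
    where
    shatters : Shatters 𝓕 A
    shatters A' A'⊆A with shattered-sound (fromList 𝓕) A (∩ₛ⊆ˡ 𝒮 (layer d) A p) A' A'⊆A
    ... | X , X∈𝓕 , X∩A≡A' = X , fromList-sound 𝓕 X∈𝓕 , X∩A≡A'

-- All sets of size < d, all d-subsets of {0, …, r - 1}, and then as many
-- larger subsets of {0, …, r - 1} as needed: the shattered d-sets are exactly
-- the d-subsets of {0, …, r - 1}.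
module Construction (n d r : ℕ) where

  in-r small core base large : SetSystem n
  in-r  = inFirst r
  small = below d
  core  = in-r ∩ₛ layer d
  base  = small ∪ₛ core
  large = in-r ∩ₛ ∁ₛ (below {n} (suc d))

  family : ℕ → Family n
  family k = members base ++ take (k ∸ card base) (members large)

  taken-large : ∀ {m X} → X ∈ take m (members large) → T (large X)
  taken-large = ∈-members⁻ large ∘′ Any-resp-⊆ (take-⊆ _ _)

  base-size : {X : Subset n} → T (base X) → ∣ X ∣ ≤ d
  base-size {X} p with to (T-∨ {small X}) p
  ... | inj₁ small-X = <⇒≤ (<ᵇ⇒< ∣ X ∣ d small-X)
  ... | inj₂ core-X  = ≤-reflexive (≡ᵇ⇒≡ ∣ X ∣ d (∩ₛ⊆ʳ in-r (layer d) X core-X))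

  large-size : {X : Subset n} → T (large X) → d < ∣ X ∣
  large-size {X} p = ≮⇒≥ λ ∣X∣<1+d →
    subst T (to T-not-≡ (∩ₛ⊆ʳ in-r (∁ₛ (below {n} (suc d))) X p)) (<⇒<ᵇ ∣X∣<1+d)

  family-unique : ∀ k → Unique (family k)
  family-unique k =
    ++⁺ (members-unique base) (take⁺ (k ∸ card base) (members-unique large)) disjoint
    where
    disjoint : ∀ {X} → ¬ (X ∈ members base × X ∈ take (k ∸ card base) (members large))
    disjoint (X∈base , X∈large) =
      <⇒≱ (large-size (taken-large X∈large)) (base-size (∈-members⁻ base X∈base))

  family-length : ∀ k → card base ≤ k → k ∸ card base ≤ card large → length (family k) ≡ k
  family-length k base≤k rest≤large = begin
    length (members base ++ take (k ∸ card base) (members large))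
      ≡⟨ length-++ (members base) ⟩
    length (members base) + length (take (k ∸ card base) (members large))
      ≡⟨ cong₂ _+_ (length-members base) (length-take (k ∸ card base) (members large)) ⟩
    card base + (k ∸ card base) ⊓ length (members large)
      ≡⟨ cong (λ l → card base + (k ∸ card base) ⊓ l) (length-members large) ⟩
    card base + (k ∸ card base) ⊓ card large
      ≡⟨ cong (card base +_) (m≤n⇒m⊓n≡m rest≤large) ⟩
    card base + (k ∸ card base)
      ≡⟨ m+[n∸m]≡n base≤k ⟩
    k ∎
    where open ≡-Reasoning

  family-large⇒in-r : ∀ k {X} → X ∈ family k → d ≤ ∣ X ∣ → T (in-r X)
  family-large⇒in-r k {X} X∈ d≤∣X∣ with ∈-++⁻ (members base) X∈
  ... | inj₂ X∈large = ∩ₛ⊆ˡ in-r (∁ₛ (below (suc d))) X (taken-large X∈large)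
  ... | inj₁ X∈base with to (T-∨ {small X}) (∈-members⁻ base X∈base)
  ...   | inj₁ small-X = ⊥-elim (<⇒≱ (<ᵇ⇒< ∣ X ∣ d small-X) d≤∣X∣)
  ...   | inj₂ core-X  = ∩ₛ⊆ˡ in-r (layer d) X core-X

  family-shatters : ∀ k A → (A ∈ members core) ⇔ ((∣ A ∣ ≡ d) × Shatters (family k) A)
  family-shatters k A = mk⇔ to-shattered from-shattered
    where
    to-shattered : A ∈ members core → (∣ A ∣ ≡ d) × Shatters (family k) A
    to-shattered A∈core = ∣A∣≡d , λ A' A'⊆A →
      A' , ∈-++⁺ˡ (∈-members⁺ base (in-base A' A'⊆A)) , ⊆⇒∩≡ A'⊆A
      where
      core-A = ∈-members⁻ core A∈core
      ∣A∣≡d = ≡ᵇ⇒≡ ∣ A ∣ d (∩ₛ⊆ʳ in-r (layer d) A core-A)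
      in-base : ∀ A' → A' ⊆ A → T (base A')
      in-base A' A'⊆A with m≤n⇒m<n∨m≡n (subst (∣ A' ∣ ≤_) ∣A∣≡d (p⊆q⇒∣p∣≤∣q∣ A'⊆A))
      ... | inj₁ ∣A'∣<d = from (T-∨ {small A'}) (inj₁ (<⇒<ᵇ ∣A'∣<d))
      ... | inj₂ ∣A'∣≡d = from (T-∨ {small A'}) (inj₂ (from (T-∧ {in-r A'})
              (inFirst-⊆ r A'⊆A (∩ₛ⊆ˡ in-r (layer d) A core-A) , ≡⇒≡ᵇ ∣ A' ∣ d ∣A'∣≡d)))
    from-shattered : (∣ A ∣ ≡ d) × Shatters (family k) A → A ∈ members core
    from-shattered (∣A∣≡d , shatters) with shatters A (λ x∈A → x∈A)
    ... | X , X∈ , X∩A≡A = ∈-members⁺ core (from (T-∧ {in-r A})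
      (inFirst-⊆ r A⊆X (family-large⇒in-r k X∈ (subst (_≤ ∣ X ∣) ∣A∣≡d (p⊆q⇒∣p∣≤∣q∣ A⊆X))) ,
       ≡⇒≡ᵇ ∣ A ∣ d ∣A∣≡d))
      where A⊆X = ∩≡⇒⊆ X∩A≡A

  card-base : r ≤ n → card base ≡ binomBelow n d + r C d
  card-base r≤n = begin
    card (small ∪ₛ core)
      ≡⟨ card-disjoint-∪ small core disjoint ⟩
    card small + card core
      ≡⟨ cong₂ _+_ (trans (card-below {n} (λ _ → true) d) (sum-applyUpTo-cong d (card-layer {n})))
                   (card-inFirst-layer r d r≤n) ⟩
    binomBelow n d + r C d ∎
    where
    open ≡-Reasoning
    disjoint : ∀ X → T (small X) → ¬ T (core X)
    disjoint X small-X core-X =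
      <-irrefl (≡ᵇ⇒≡ ∣ X ∣ d (∩ₛ⊆ʳ in-r (layer d) X core-X)) (<ᵇ⇒< ∣ X ∣ d small-X)

  card-large : d ≤ r → r ≤ n → card large ≡ sumFromTo (suc d) r (r C_)
  card-large d≤r r≤n = +-cancelˡ-≡ (card (in-r ∩ₛ below {n} (suc d))) _ _ (begin
    card (in-r ∩ₛ below {n} (suc d)) + card large
      ≡⟨ card-split in-r (below {n} (suc d)) ⟨
    card in-r
      ≡⟨ card-cong all-below ⟩
    card (in-r ∩ₛ below {n} (suc r))
      ≡⟨ card-first-layers (suc r) ⟩
    sum (applyUpTo (r C_) (suc r))
      ≡⟨ cong (λ m → sum (applyUpTo (r C_) m)) (cong suc (m+[n∸m]≡n d≤r)) ⟨
    sum (applyUpTo (r C_) (suc d + (r ∸ d)))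
      ≡⟨ sum-applyUpTo-+ (r C_) (suc d) (r ∸ d) ⟩
    sum (applyUpTo (r C_) (suc d)) + sumFromTo (suc d) r (r C_)
      ≡⟨ cong (_+ sumFromTo (suc d) r (r C_)) (card-first-layers (suc d)) ⟨
    card (in-r ∩ₛ below {n} (suc d)) + sumFromTo (suc d) r (r C_) ∎)
    where
    open ≡-Reasoning
    card-first-layers : ∀ b → card (in-r ∩ₛ below b) ≡ sum (applyUpTo (r C_) b)
    card-first-layers b =
      trans (card-below in-r b) (sum-applyUpTo-cong b (λ i → card-inFirst-layer r i r≤n))
    all-below : ∀ A → in-r A ≡ (in-r ∩ₛ below {n} (suc r)) A
    all-below A with in-r A in eq
    ... | false = refl
    ... | true  = sym (to T-≡ (<⇒<ᵇ (s≤s (inFirst-size r (subst T (sym eq) tt)))))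

upper-bound : ∀ {n d r k} → d ≤ r → r ≤ n →
              binomBelow n d + r C d ≤ k → k ≤ binomBelow n d + sumFromTo d r (r C_) →
              Σ (Family n) λ 𝓕 → Unique 𝓕 × length 𝓕 ≡ k × NumShattered 𝓕 d (r C d)
upper-bound {n} {d} {r} {k} d≤r r≤n k-large k-small =
  family k , family-unique k , family-length k base≤k rest≤large ,
  members core , members-unique core , trans (length-members core) (card-inFirst-layer r d r≤n) ,
  family-shatters k
  where
  open Construction n d r
  base≤k : card base ≤ k
  base≤k = subst (_≤ k) (sym (card-base r≤n)) k-large
  rest≤large : k ∸ card base ≤ card large
  rest≤large = m≤n+o⇒m∸n≤o k (card base) (begin
    k
      ≤⟨ k-small ⟩
    binomBelow n d + sumFromTo d r (r C_)
      ≡⟨ cong (binomBelow n d +_) (sumFromTo-unfold (r C_) d≤r) ⟩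
    binomBelow n d + (r C d + sumFromTo (suc d) r (r C_))
      ≡⟨ +-assoc (binomBelow n d) (r C d) _ ⟨
    binomBelow n d + r C d + sumFromTo (suc d) r (r C_)
      ≡⟨ cong₂ _+_ (card-base r≤n) (card-large d≤r r≤n) ⟨
    card base + card large ∎)
    where open ≤-Reasoning

mainTheorem17 : (n d r k : ℕ) → 1 ≤ d → d ≤ r → r ≤ n →
    binomBelow n d + r C d + sumFromTo (suc d) (r ∸ 1) (λ i → r C i ∸ 1) ≤ k →
    k ≤ binomBelow n d + sumFromTo d r (λ i → r C i) →
    IsG n k d (r C d)
mainTheorem17 n d r k _ d≤r r≤n k-lower k-upper =
  lower-bound d≤r r≤n k-lower ,
  upper-bound d≤r r≤n (≤-trans (m≤m+n _ _) k-lower) k-upper
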